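{- Let $n\geq 3$ and $l>n$ be integers, and let $K_n^l$ be the multigraph on $n$ vertices in which every pair of distinct vertices is joined by exactly $l$ parallel edges. Then $\mathrm{scw}(K_3\circ K_n^l)=n$, and any tree-cut decomposition of $K_3\circ K_n^l$ of width $n$ contains at least one empty bag.
   Context: All graphs are finite connected multigraphs (multiple edges allowed, no loops). $K_3$ is the complete simple graph on 3 vertices. For graphs $G,H$ with $H$ vertex-transitive, the rooted product $G\circ H$ consists of a copy of $G$ together with $|V(G)|$ copies of $H$, each copy glued at one of its vertices to a different vertex of $G$. Screewidth: a tree-cut decomposition of a graph $G$ is a pair $(T,\mathcal{X})$ with $T$ a tree (vertices = nodes, edges = links) and $\mathcal{X}=\{X_b: b\in V(T)\}$ pairwise disjoint, possibly empty subsets of $V(G)$ (bags) with union $V(G)$. For a link $l$, $\mathrm{adh}(l)$ is the set of edges of $G$ with endpoints in bags $X_b,X_d$ where $b,d$ lie in different components of $T-l$; for a node $b$, $\mathrm{adh}(b)$ is the set of edges of $G$ with endpoints in bags $X_c,X_d$ where $c,d$ lie in different components of $T-b$. The width is $\max\{\max_l|\mathrm{adh}(l)|,\ \max_b(|X_b|+|\mathrm{adh}(b)|)\}$, and $\mathrm{scw}(G)$ is the minimum width over all tree-cut decompositions of $G$. -}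

module Defs where

open import Data.Nat using (ℕ; zero; suc; _+_; _*_; _<ᵇ_; _⊔_)
open import Data.Fin using (Fin; zero; suc; toℕ; remQuot)
open import Data.Fin.Properties using (_≟_)
open import Data.Bool using (Bool; true; false; if_then_else_; _∧_; not; _xor_)
open import Data.List using (List; []; _∷_)
open import Data.Bool.ListAction using (any)
open import Data.Maybe using (Maybe; just; nothing)
open import Data.Product using (_×_; _,_)
open import Relation.Nullary.Decidable using (⌊_⌋)
open import Relation.Binary.PropositionalEquality using (_≡_; refl; cong₂)
open import Relation.Nullary using (yes; no)
open import Data.Bool.Properties using (∧-comm)

sumFin : ∀ {N} → (Fin N → ℕ) → ℕ
sumFin {zero}  f = 0
sumFin {suc N} f = f zero + sumFin (λ i → f (suc i))

maxFin : ∀ {N} → (Fin N → ℕ) → ℕ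
maxFin {zero}  f = 0
maxFin {suc N} f = f zero ⊔ maxFin (λ i → f (suc i))

_==_ : ∀ {N} → Fin N → Fin N → Bool
i == j = ⌊ i ≟ j ⌋

-- Finite loopless multigraphs on vertex set Fin N, given by an edge
-- multiplicity function (number of parallel edges between u and w).

record Multigraph : Set where
  field
    N        : ℕ
    mult     : Fin N → Fin N → ℕ
    mult-sym : ∀ u w → mult u w ≡ mult w u
    loopless : ∀ u → mult u u ≡ 0
open Multigraph public

countEdges : (G : Multigraph) → (Fin (N G) → Fin (N G) → Bool) → ℕ
countEdges G P =
  sumFin (λ u → sumFin (λ w →
    if (toℕ u <ᵇ toℕ w) ∧ P u w then mult G u w else 0))

-- A finite tree with nodes Fin (suc k) is given (up to
-- relabelling) by a parent function: node (suc i) has parent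
-- (parent i), whose index is ≤ i (so strictly smaller than suc i);
-- node zero is the root.  The links are the pairs {suc i, parent i}.

record RootedTree : Set where
  field
    k         : ℕ
    parent    : Fin k → Fin (suc k)
    parent-lt : ∀ i → toℕ (parent i) Data.Nat.≤ toℕ i
open RootedTree public

-- path from a node up to the root (fuel suffices since parents decrease)
pathUpF : (T : RootedTree) → ℕ → Fin (suc (k T)) → List (Fin (suc (k T)))
pathUpF T zero    x       = x ∷ []
pathUpF T (suc f) zero    = zero ∷ []
pathUpF T (suc f) (suc i) = suc i ∷ pathUpF T f (parent T i)

pathUp : (T : RootedTree) → Fin (suc (k T)) → List (Fin (suc (k T)))
pathUp T = pathUpF T (k T)

inSubtree : (T : RootedTree) → Fin (suc (k T)) → Fin (suc (k T)) → Bool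
inSubtree T a x = any (λ y → y == a) (pathUp T x)

-- For nodes x ≠ b: the component of T - b containing x, labelled by
-- the child of b on the path from x up to b ("just c"), or "nothing"
-- for the component containing the parent side of b.
compLabel : (T : RootedTree) → Fin (suc (k T)) → Fin (suc (k T)) → Maybe (Fin (suc (k T)))
compLabel T b x = go (pathUp T x)
  where
  go : List (Fin (suc (k T))) → Maybe (Fin (suc (k T)))
  go (y ∷ z ∷ rest) = if z == b then just y else go (z ∷ rest)
  go _ = nothing

eqLabel : ∀ {M} → Maybe (Fin M) → Maybe (Fin M) → Bool
eqLabel nothing  nothing  = true
eqLabel (just a) (just b) = a == b
eqLabel _        _        = false

-- Tree-cut decompositions: a tree together with an assignment of each
-- vertex of G to a node (its bag).  Bags are thus pairwise disjoint with
-- union V(G); bags may be empty.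

record TreeCutDecomposition (G : Multigraph) : Set where
  field
    tree : RootedTree
    bag  : Fin (N G) → Fin (suc (k tree))
open TreeCutDecomposition public

module _ {G : Multigraph} (D : TreeCutDecomposition G) where
  private
    T = tree D

  adhLink : Fin (k T) → ℕ
  adhLink i = countEdges G (λ u w →
    inSubtree T (suc i) (bag D u) xor inSubtree T (suc i) (bag D w))

  bagSize : Fin (suc (k T)) → ℕ
  bagSize b = sumFin (λ v → if bag D v == b then 1 else 0)

  adhNode : Fin (suc (k T)) → ℕ
  adhNode b = countEdges G (λ u w →
    not (bag D u == b) ∧ not (bag D w == b) ∧
    not (eqLabel (compLabel T b (bag D u)) (compLabel T b (bag D w))))

  width : ℕ
  width = maxFin adhLink ⊔ maxFin (λ b → bagSize b + adhNode b)

EmptyBag : ∀ {G} (D : TreeCutDecomposition G) → Fin (suc (k (tree D))) → Set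
EmptyBag D b = ∀ v → bag D v ≡ b → Data.Empty.⊥
  where import Data.Empty

-- K₃ ∘ Kₙˡ: vertices Fin (3 * n) ≅ Fin 3 × Fin n via remQuot; vertex
-- (i , j) is vertex j of the i-th copy of Kₙˡ, and the copy i is glued
-- to vertex i of K₃ at its vertex j = 0.

multPair : ∀ {n} (l : ℕ) → Fin 3 × Fin n → Fin 3 × Fin n → ℕ
multPair l (i , j) (i' , j') =
  if i == i'
    then (if j == j' then 0 else l)
    else (if (toℕ j Data.Nat.≡ᵇ 0) ∧ (toℕ j' Data.Nat.≡ᵇ 0) then 1 else 0)

multK3∘Knl : (n l : ℕ) → Fin (3 * n) → Fin (3 * n) → ℕ
multK3∘Knl n l u w = multPair l (remQuot {3} n u) (remQuot {3} n w)

==-sym : ∀ {M} (a b : Fin M) → (a == b) ≡ (b == a)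
==-sym a b with a ≟ b | b ≟ a
... | yes _ | yes _ = refl
... | no _  | no _  = refl
... | yes refl | no ¬p = Data.Empty.⊥-elim (¬p refl)
  where import Data.Empty
... | no ¬p | yes refl = Data.Empty.⊥-elim (¬p refl)
  where import Data.Empty

==-refl : ∀ {M} (a : Fin M) → (a == a) ≡ true
==-refl a with a ≟ a
... | yes _ = refl
... | no ¬p = Data.Empty.⊥-elim (¬p refl)
  where import Data.Empty

multPair-sym : ∀ {n} l (p q : Fin 3 × Fin n) → multPair l p q ≡ multPair l q p
multPair-sym l (i , j) (i' , j')
  rewrite ==-sym i i' | ==-sym j j'
        | ∧-comm (toℕ j Data.Nat.≡ᵇ 0) (toℕ j' Data.Nat.≡ᵇ 0) = refl

multPair-loopless : ∀ {n} l (p : Fin 3 × Fin n) → multPair l p p ≡ 0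
multPair-loopless l (i , j) rewrite ==-refl i | ==-refl j = refl

multK3∘Knl-sym : ∀ n l u w → multK3∘Knl n l u w ≡ multK3∘Knl n l w u
multK3∘Knl-sym n l u w = multPair-sym l (remQuot {3} n u) (remQuot {3} n w)

multK3∘Knl-loopless : ∀ n l u → multK3∘Knl n l u u ≡ 0
multK3∘Knl-loopless n l u = multPair-loopless l (remQuot {3} n u)

K3∘Knl : (n l : ℕ) → Multigraph
K3∘Knl n l = record
  { N = 3 * n
  ; mult = multK3∘Knl n l
  ; mult-sym = multK3∘Knl-sym n l
  ; loopless = multK3∘Knl-loopless n l }

ScwEquals : Multigraph → ℕ → Set
ScwEquals G w =
  Data.Product.Σ (TreeCutDecomposition G) (λ D → width D ≡ w)
  × (∀ (D : TreeCutDecomposition G) → w Data.Nat.≤ width D)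

-- Lower bound: a copy of Kₙˡ cut by a link puts at least l > n edges
-- into its adhesion, so some bag contains a whole copy and the width is
-- at least n.  The bound is attained by a star whose empty centre has
-- the three copies as leaves (link adhesion 2, centre adhesion 3 ≤ n).
-- In a decomposition of width n each copy lies in a single bag and no
-- two copies share one, so if no bag were empty the tree would have
-- exactly three nodes, hence be a path; its middle node holds a copy
-- and also separates the K₃-edge between the other two, giving width
-- at least n + 1.
{-# OPTIONS --safe #-}
module Submission where

open import Defs
open import Data.Nat using (ℕ; zero; suc; _+_; _*_; _≤_; _<_; z≤n; s≤s; _<ᵇ_; _≡ᵇ_; _⊔_)
open import Data.Nat.Properties
open import Data.Fin using (Fin; zero; suc; toℕ; _↑ˡ_; _↑ʳ_; combine; remQuot)
open import Data.Fin.Properties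
  using (toℕ-injective; remQuot-combine; combine-remQuot; all?; any?; ¬∀⟶∃¬; injective⇒≤)
  renaming (_≟_ to _≟ᶠ_)
open import Data.Bool using (Bool; true; false; if_then_else_; _∧_; not; _xor_)
open import Data.Bool.Properties using (xor-comm; ∧-zeroʳ)
open import Data.Bool.ListAction using (any)
open import Data.Maybe using (Maybe; just; nothing)
open import Data.Product using (_×_; _,_; proj₁; proj₂; ∃; ∃₂)
open import Data.Sum using (_⊎_; inj₁; inj₂)
open import Data.Empty using (⊥-elim)
open import Function.Definitions using (Injective)
open import Relation.Nullary using (yes; no; ¬_)
open import Relation.Binary using (tri<; tri≈; tri>)
open import Relation.Binary.PropositionalEquality
open import Algebra.Properties.CommutativeSemigroup +-commutativeSemigroup using (interchange)

-- Finite sums and maxima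

sumFin-cong : ∀ {N} {f g : Fin N → ℕ} → (∀ i → f i ≡ g i) → sumFin f ≡ sumFin g
sumFin-cong {zero}  f≗g = refl
sumFin-cong {suc N} f≗g = cong₂ _+_ (f≗g zero) (sumFin-cong (λ i → f≗g (suc i)))

sumFin-zero : ∀ N → sumFin {N} (λ _ → 0) ≡ 0
sumFin-zero zero    = refl
sumFin-zero (suc N) = sumFin-zero N

sumFin-one : ∀ N → sumFin {N} (λ _ → 1) ≡ N
sumFin-one zero    = refl
sumFin-one (suc N) = cong suc (sumFin-one N)

sumFin-if : ∀ {N} (β : Bool) (f g : Fin N → ℕ) →
  sumFin (λ i → if β then f i else g i) ≡ (if β then sumFin f else sumFin g)
sumFin-if true  f g = refl
sumFin-if false f g = refl

sumFin² : ∀ {M N} → (Fin M → Fin N → ℕ) → ℕ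
sumFin² f = sumFin (λ i → sumFin (f i))

sumFin²-zero : ∀ M N → sumFin² {M} {N} (λ _ _ → 0) ≡ 0
sumFin²-zero M N = trans (sumFin-cong {M} (λ _ → sumFin-zero N)) (sumFin-zero M)

sumFin²-if : ∀ {M N} (β : Bool) (f g : Fin M → Fin N → ℕ) →
  sumFin² (λ i j → if β then f i j else g i j) ≡ (if β then sumFin² f else sumFin² g)
sumFin²-if true  f g = refl
sumFin²-if false f g = refl

sumFin-+ : ∀ {N} (f g : Fin N → ℕ) → sumFin (λ i → f i + g i) ≡ sumFin f + sumFin g
sumFin-+ {zero}  f g = refl
sumFin-+ {suc N} f g =
  trans (cong (f zero + g zero +_) (sumFin-+ (λ i → f (suc i)) (λ i → g (suc i))))
        (interchange (f zero) (g zero) _ _)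

sumFin-comm : ∀ {A B} (f : Fin A → Fin B → ℕ) →
  sumFin (λ i → sumFin (f i)) ≡ sumFin (λ j → sumFin (λ i → f i j))
sumFin-comm {zero}  {B} f = sym (sumFin-zero B)
sumFin-comm {suc A} f =
  trans (cong (sumFin (f zero) +_) (sumFin-comm (λ i → f (suc i))))
        (sym (sumFin-+ (f zero) (λ j → sumFin (λ i → f (suc i) j))))

sumFin-++ : ∀ m n (f : Fin (m + n) → ℕ) →
  sumFin f ≡ sumFin (λ i → f (i ↑ˡ n)) + sumFin (λ j → f (m ↑ʳ j))
sumFin-++ zero    n f = refl
sumFin-++ (suc m) n f =
  trans (cong (f zero +_) (sumFin-++ m n (λ i → f (suc i)))) (sym (+-assoc (f zero) _ _))

sumFin-combine : ∀ m n (f : Fin (m * n) → ℕ) →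
  sumFin f ≡ sumFin {m} (λ c → sumFin {n} (λ j → f (combine c j)))
sumFin-combine zero    n f = refl
sumFin-combine (suc m) n f =
  trans (sumFin-++ n (m * n) f)
        (cong (sumFin (λ i → f (i ↑ˡ (m * n))) +_) (sumFin-combine m n (λ i → f (n ↑ʳ i))))

term≤sumFin : ∀ {N} (f : Fin N → ℕ) i → f i ≤ sumFin f
term≤sumFin f zero    = m≤m+n _ _
term≤sumFin f (suc i) = ≤-trans (term≤sumFin (λ j → f (suc j)) i) (m≤n+m _ (f zero))

twoTerms≤sumFin : ∀ {N} (f : Fin N → ℕ) {i j} → ¬ i ≡ j → f i + f j ≤ sumFin f
twoTerms≤sumFin f {zero}  {zero}  i≢j = ⊥-elim (i≢j refl)
twoTerms≤sumFin f {zero}  {suc j} i≢j = +-monoʳ-≤ (f zero) (term≤sumFin (λ j → f (suc j)) j)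
twoTerms≤sumFin f {suc i} {zero}  i≢j =
  ≤-trans (≤-reflexive (+-comm (f (suc i)) (f zero)))
          (+-monoʳ-≤ (f zero) (term≤sumFin (λ j → f (suc j)) i))
twoTerms≤sumFin f {suc i} {suc j} i≢j =
  ≤-trans (twoTerms≤sumFin (λ j → f (suc j)) (λ i≡j → i≢j (cong suc i≡j))) (m≤n+m _ (f zero))

sumFin-indicator-all : ∀ {N} (P : Fin N → Bool) → (∀ i → P i ≡ true) →
  sumFin (λ i → if P i then 1 else 0) ≡ N
sumFin-indicator-all {N} P all-P = trans (sumFin-cong one) (sumFin-one N)
  where
  one : ∀ i → (if P i then 1 else 0) ≡ 1
  one i rewrite all-P i = refl

term≤maxFin : ∀ {N} (f : Fin N → ℕ) i → f i ≤ maxFin f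
term≤maxFin f zero    = m≤m⊔n _ _
term≤maxFin f (suc i) = ≤-trans (term≤maxFin (λ j → f (suc j)) i) (m≤n⊔m (f zero) _)

maxFin-lub : ∀ {N} (f : Fin N → ℕ) {c} → (∀ i → f i ≤ c) → maxFin f ≤ c
maxFin-lub {zero}  f f≤c = z≤n
maxFin-lub {suc N} f f≤c = ⊔-lub (f≤c zero) (maxFin-lub (λ i → f (suc i)) (λ i → f≤c (suc i)))

+-self-injective : ∀ {a b} → a + a ≡ b + b → a ≡ b
+-self-injective {a} {b} a+a≡b+b = *-cancelˡ-≡ a b 2 (begin
  a + (a + 0) ≡⟨ cong (a +_) (+-identityʳ a) ⟩
  a + a       ≡⟨ a+a≡b+b ⟩
  b + b       ≡⟨ cong (b +_) (+-identityʳ b) ⟨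
  b + (b + 0) ∎)
  where open ≡-Reasoning

==⇒≡ : ∀ {M} {a b : Fin M} → (a == b) ≡ true → a ≡ b
==⇒≡ {a = a} {b} a==b with a ≟ᶠ b
... | yes a≡b = a≡b

≢⇒==false : ∀ {M} {a b : Fin M} → ¬ a ≡ b → (a == b) ≡ false
≢⇒==false {a = a} {b} a≢b with a ≟ᶠ b
... | yes a≡b = ⊥-elim (a≢b a≡b)
... | no _    = refl

<⇒<ᵇ≡true : ∀ {m n} → m < n → (m <ᵇ n) ≡ true
<⇒<ᵇ≡true {zero}  {suc n} _         = refl
<⇒<ᵇ≡true {suc m} {suc n} (s≤s m<n) = <⇒<ᵇ≡true m<n

≤⇒<ᵇ≡false : ∀ {m n} → n ≤ m → (m <ᵇ n) ≡ false
≤⇒<ᵇ≡false {m}     {zero}  _         = refl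
≤⇒<ᵇ≡false {suc m} {suc n} (s≤s n≤m) = ≤⇒<ᵇ≡false n≤m

-- Edge counting

SymmetricRel : (G : Multigraph) → (Fin (N G) → Fin (N G) → Bool) → Set
SymmetricRel G P = ∀ u w → P u w ≡ P w u

countArcs : (G : Multigraph) → (Fin (N G) → Fin (N G) → Bool) → ℕ
countArcs G P = sumFin (λ u → sumFin (λ w → if P u w then mult G u w else 0))

mult≤countEdges : (G : Multigraph) (P : Fin (N G) → Fin (N G) → Bool) → SymmetricRel G P →
  ∀ u w → P u w ≡ true → mult G u w ≤ countEdges G P
mult≤countEdges G P P-sym u w Puw with <-cmp (toℕ u) (toℕ w)
... | tri< u<w _ _ =
  ≤-trans (≤-reflexive (sym uw-term)) (≤-trans (term≤sumFin _ w) (term≤sumFin _ u))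
  where
  uw-term : (if (toℕ u <ᵇ toℕ w) ∧ P u w then mult G u w else 0) ≡ mult G u w
  uw-term rewrite <⇒<ᵇ≡true u<w | Puw = refl
... | tri≈ _ u≡w _ rewrite toℕ-injective {i = u} {j = w} u≡w | loopless G w = z≤n
... | tri> _ _ w<u =
  ≤-trans (≤-reflexive (sym wu-term)) (≤-trans (term≤sumFin _ u) (term≤sumFin _ w))
  where
  wu-term : (if (toℕ w <ᵇ toℕ u) ∧ P w u then mult G w u else 0) ≡ mult G u w
  wu-term rewrite <⇒<ᵇ≡true w<u | P-sym w u | Puw = mult-sym G w u

countEdges-false : (G : Multigraph) (P : Fin (N G) → Fin (N G) → Bool) →
  (∀ u w → P u w ≡ false) → countEdges G P ≡ 0
countEdges-false G P P-false =
  trans (sumFin-cong (λ u → trans (sumFin-cong (term-zero u)) (sumFin-zero (N G))))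
        (sumFin-zero (N G))
  where
  term-zero : ∀ u w → (if (toℕ u <ᵇ toℕ w) ∧ P u w then mult G u w else 0) ≡ 0
  term-zero u w rewrite P-false u w | ∧-zeroʳ (toℕ u <ᵇ toℕ w) = refl

countEdges-double : (G : Multigraph) (P : Fin (N G) → Fin (N G) → Bool) → SymmetricRel G P →
  countEdges G P + countEdges G P ≡ countArcs G P
countEdges-double G P P-sym = sym (begin
  countArcs G P
    ≡⟨ sumFin-cong (λ u → sumFin-cong (split u)) ⟩
  sumFin (λ u → sumFin (λ w → A u w + A w u))
    ≡⟨ sumFin-cong (λ u → sumFin-+ (A u) (λ w → A w u)) ⟩
  sumFin (λ u → sumFin (A u) + sumFin (λ w → A w u))
    ≡⟨ sumFin-+ (λ u → sumFin (A u)) (λ u → sumFin (λ w → A w u)) ⟩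
  countEdges G P + sumFin (λ u → sumFin (λ w → A w u))
    ≡⟨ cong (countEdges G P +_) (sumFin-comm (λ u w → A w u)) ⟩
  countEdges G P + countEdges G P ∎)
  where
  open ≡-Reasoning
  A : Fin (N G) → Fin (N G) → ℕ
  A u w = if (toℕ u <ᵇ toℕ w) ∧ P u w then mult G u w else 0
  split : ∀ u w → (if P u w then mult G u w else 0) ≡ A u w + A w u
  split u w with <-cmp (toℕ u) (toℕ w)
  ... | tri< u<w _ _ rewrite <⇒<ᵇ≡true u<w | ≤⇒<ᵇ≡false (<⇒≤ u<w) = sym (+-identityʳ _)
  ... | tri> _ _ w<u rewrite <⇒<ᵇ≡true w<u | ≤⇒<ᵇ≡false (<⇒≤ w<u)
                           | P-sym u w | mult-sym G u w = refl
  ... | tri≈ _ u≡w _ rewrite toℕ-injective {i = u} {j = w} u≡w | ≤⇒<ᵇ≡false (≤-refl {toℕ w})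
                           | loopless G w with P w w
  ...   | true  = refl
  ...   | false = refl

-- Trees

Node : RootedTree → Set
Node T = Fin (suc (k T))

crossesLink : (T : RootedTree) → Fin (k T) → Node T → Node T → Bool
crossesLink T i x y = inSubtree T (suc i) x xor inSubtree T (suc i) y

separatedByNode : (T : RootedTree) → Node T → Node T → Node T → Bool
separatedByNode T b x y =
  not (x == b) ∧ not (y == b) ∧ not (eqLabel (compLabel T b x) (compLabel T b y))

∈pathUpF⇒≤ : (T : RootedTree) (f : ℕ) (x a : Node T) →
  any (_== a) (pathUpF T f x) ≡ true → toℕ a ≤ toℕ x
∈pathUpF⇒≤ T zero x a x∈ with x == a in x==a
... | true = ≤-reflexive (cong toℕ (sym (==⇒≡ x==a)))
∈pathUpF⇒≤ T (suc f) zero a x∈ with zero == a in x==a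
... | true = ≤-reflexive (cong toℕ (sym (==⇒≡ x==a)))
∈pathUpF⇒≤ T (suc f) (suc i) a x∈ with suc i == a in x==a
... | true  = ≤-reflexive (cong toℕ (sym (==⇒≡ x==a)))
... | false = ≤-trans (∈pathUpF⇒≤ T f (parent T i) a x∈) (≤-trans (parent-lt T i) (n≤1+n _))

inSubtree-self : (T : RootedTree) (x : Node T) → inSubtree T x x ≡ true
inSubtree-self T x = go (k T) x
  where
  go : ∀ f x → any (_== x) (pathUpF T f x) ≡ true
  go zero    x       rewrite ==-refl x = refl
  go (suc f) zero    = refl
  go (suc f) (suc i) rewrite ==-refl (suc i) = refl

inSubtree-below : (T : RootedTree) (a x : Node T) → toℕ x < toℕ a → inSubtree T a x ≡ false
inSubtree-below T a x x<a with inSubtree T a x in x∈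
... | false = refl
... | true  = ⊥-elim (<⇒≱ x<a (∈pathUpF⇒≤ T (k T) x a x∈))

-- The link above the larger of two distinct nodes separates them.
distinct⇒crossesLink : (T : RootedTree) (x y : Node T) → ¬ x ≡ y →
  ∃ λ i → crossesLink T i x y ≡ true
distinct⇒crossesLink T x y x≢y with <-cmp (toℕ x) (toℕ y)
... | tri≈ _ x≡y _ = ⊥-elim (x≢y (toℕ-injective x≡y))
distinct⇒crossesLink T x (suc j) x≢y | tri< x<y _ _ =
  j , cong₂ _xor_ (inSubtree-below T (suc j) x x<y) (inSubtree-self T (suc j))
distinct⇒crossesLink T (suc i) y x≢y | tri> _ _ y<x =
  i , cong₂ _xor_ (inSubtree-self T (suc i)) (inSubtree-below T (suc i) y y<x)

crossesLink-sym : (T : RootedTree) (i : Fin (k T)) (x y : Node T) →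
  crossesLink T i x y ≡ crossesLink T i y x
crossesLink-sym T i x y = xor-comm (inSubtree T (suc i) x) (inSubtree T (suc i) y)

eqLabel-sym : ∀ {M} (x y : Maybe (Fin M)) → eqLabel x y ≡ eqLabel y x
eqLabel-sym nothing  nothing  = refl
eqLabel-sym nothing  (just _) = refl
eqLabel-sym (just _) nothing  = refl
eqLabel-sym (just a) (just b) = ==-sym a b

separatedByNode-sym : (T : RootedTree) (b x y : Node T) →
  separatedByNode T b x y ≡ separatedByNode T b y x
separatedByNode-sym T b x y with x == b | y == b
... | true  | true  = refl
... | true  | false = refl
... | false | true  = refl
... | false | false = cong not (eqLabel-sym (compLabel T b x) (compLabel T b y))

toℕ≤0⇒zero : ∀ {N} (a : Fin (suc N)) → toℕ a ≤ 0 → a ≡ zero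
toℕ≤0⇒zero zero _ = refl

-- A three-node tree is a path; b is its middle node.
threeNodeTree-middle : (T : RootedTree) → k T ≡ 2 →
  ∃ λ b → ∃₂ λ x y → ¬ x ≡ y × separatedByNode T b x y ≡ true
threeNodeTree-middle T@record { k = .2 ; parent = p ; parent-lt = p≤ } refl
  with p (suc zero) in p₁ | p≤ (suc zero)
... | zero | _ = zero , suc zero , suc (suc zero) , (λ ()) , separated
  where
  separated : separatedByNode T zero (suc zero) (suc (suc zero)) ≡ true
  separated rewrite toℕ≤0⇒zero (p zero) (p≤ zero) | p₁ = refl
... | suc zero | _ = suc zero , zero , suc (suc zero) , (λ ()) , separated
  where
  separated : separatedByNode T (suc zero) zero (suc (suc zero)) ≡ true
  separated rewrite p₁ = refl
... | suc (suc _) | s≤s ()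

module _ {G : Multigraph} (D : TreeCutDecomposition G) where

  adhLink≤width : ∀ i → adhLink D i ≤ width D
  adhLink≤width i = ≤-trans (term≤maxFin (adhLink D) i) (m≤m⊔n _ _)

  bagSize+adhNode≤width : ∀ b → bagSize D b + adhNode D b ≤ width D
  bagSize+adhNode≤width b =
    ≤-trans (term≤maxFin (λ b → bagSize D b + adhNode D b) b) (m≤n⊔m (maxFin (adhLink D)) _)

-- The graph K₃ ∘ Kₙˡ

module K3∘Knl-Properties (m l : ℕ) where

  n : ℕ
  n = suc m

  G : Multigraph
  G = K3∘Knl n l

  vertex : Fin 3 → Fin n → Fin (3 * n)
  vertex = combine

  mult-vertex : ∀ c j c' j' → mult G (vertex c j) (vertex c' j') ≡ multPair l (c , j) (c' , j')
  mult-vertex c j c' j' =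
    cong₂ (multPair l) (remQuot-combine {3} {n} c j) (remQuot-combine {3} {n} c' j')

  mult-withinCopy : ∀ c (j : Fin n) → ¬ j ≡ zero → multPair l (c , zero) (c , j) ≡ l
  mult-withinCopy c zero    j≢0 = ⊥-elim (j≢0 refl)
  mult-withinCopy c (suc j) j≢0 rewrite ==-refl c = refl

  mult-betweenRoots : ∀ c c' → ¬ c ≡ c' → multPair {n} l (c , zero) (c' , zero) ≡ 1
  mult-betweenRoots c c' c≢c' rewrite ≢⇒==false c≢c' = refl

  module _ (D : TreeCutDecomposition G) where

    copyOneBag-or-heavyLink : ∀ c →
      (∀ j → bag D (vertex c j) ≡ bag D (vertex c zero)) ⊎ (∃ λ i → l ≤ adhLink D i)
    copyOneBag-or-heavyLink c with all? (λ j → bag D (vertex c j) ≟ᶠ bag D (vertex c zero))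
    ... | yes oneBag = inj₁ oneBag
    ... | no ¬oneBag with ¬∀⟶∃¬ n _ (λ j → bag D (vertex c j) ≟ᶠ bag D (vertex c zero)) ¬oneBag
    ... | j , j-apart with distinct⇒crossesLink (tree D) _ _ (λ b₀≡bⱼ → j-apart (sym b₀≡bⱼ))
    ... | i , crosses = inj₂ (i , ≤-trans (≤-reflexive (sym l-edges))
          (mult≤countEdges G (λ u w → crossesLink (tree D) i (bag D u) (bag D w))
            (λ u w → crossesLink-sym (tree D) i (bag D u) (bag D w)) _ _ crosses))
      where
      j≢0 : ¬ j ≡ zero
      j≢0 refl = j-apart refl
      l-edges : mult G (vertex c zero) (vertex c j) ≡ l
      l-edges = trans (mult-vertex c zero c j) (mult-withinCopy c j j≢0)

    copyInBag : Node (tree D) → Fin 3 → ℕ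
    copyInBag b c = sumFin {n} (λ j → if bag D (vertex c j) == b then 1 else 0)

    copyInBag-full : ∀ c b → (∀ j → bag D (vertex c j) ≡ b) → copyInBag b c ≡ n
    copyInBag-full c b inB =
      sumFin-indicator-all _ (λ j → trans (cong (_== b) (inB j)) (==-refl b))

    bagSize-byCopy : ∀ b → bagSize D b ≡ sumFin (copyInBag b)
    bagSize-byCopy b = sumFin-combine 3 n (λ v → if bag D v == b then 1 else 0)

    copy⊆bag⇒n≤bagSize : ∀ c b → (∀ j → bag D (vertex c j) ≡ b) → n ≤ bagSize D b
    copy⊆bag⇒n≤bagSize c b inB =
      subst₂ _≤_ (copyInBag-full c b inB) (sym (bagSize-byCopy b)) (term≤sumFin (copyInBag b) c)

    twoCopies⊆bag⇒n+n≤bagSize : ∀ c c' b → ¬ c ≡ c' →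
      (∀ j → bag D (vertex c j) ≡ b) → (∀ j → bag D (vertex c' j) ≡ b) → n + n ≤ bagSize D b
    twoCopies⊆bag⇒n+n≤bagSize c c' b c≢c' inB inB' =
      subst₂ _≤_ (cong₂ _+_ (copyInBag-full c b inB) (copyInBag-full c' b inB'))
        (sym (bagSize-byCopy b)) (twoTerms≤sumFin (copyInBag b) c≢c')

  scw-lowerBound : n < l → ∀ D → n ≤ width D
  scw-lowerBound n<l D with copyOneBag-or-heavyLink D zero
  ... | inj₁ oneBag =
    ≤-trans (copy⊆bag⇒n≤bagSize D zero _ oneBag) (≤-trans (m≤m+n _ _) (bagSize+adhNode≤width D _))
  ... | inj₂ (i , l≤adh) = ≤-trans (<⇒≤ n<l) (≤-trans l≤adh (adhLink≤width D i))

  module NarrowDecomposition (n<l : n < l) (D : TreeCutDecomposition G) (width≤n : width D ≤ n)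
    where

    copyBag : Fin 3 → Node (tree D)
    copyBag c = bag D (vertex c zero)

    IsCopyBag : Node (tree D) → Set
    IsCopyBag b = ∃ λ c → copyBag c ≡ b

    Surjective-copyBag : Set
    Surjective-copyBag = ∀ b → IsCopyBag b

    copy⊆copyBag : ∀ c j → bag D (vertex c j) ≡ copyBag c
    copy⊆copyBag c with copyOneBag-or-heavyLink D c
    ... | inj₁ oneBag      = oneBag
    ... | inj₂ (i , l≤adh) = ⊥-elim (<⇒≱ n<l (≤-trans l≤adh (≤-trans (adhLink≤width D i) width≤n)))

    copyBag-injective : Injective _≡_ _≡_ copyBag
    copyBag-injective {c} {c'} same with c ≟ᶠ c'
    ... | yes c≡c' = c≡c'
    ... | no c≢c'  = ⊥-elim (n+n≰n (≤-trans
          (twoCopies⊆bag⇒n+n≤bagSize D c c' (copyBag c) c≢c' (copy⊆copyBag c)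
            (λ j → trans (copy⊆copyBag c' j) (sym same)))
          (≤-trans (m≤m+n _ _) (≤-trans (bagSize+adhNode≤width D (copyBag c)) width≤n))))
      where
      n+n≰n : ¬ n + n ≤ n
      n+n≰n = <⇒≱ (m<m+n n {n} (s≤s z≤n))

    notCopyBag⇒empty : ∀ b → ¬ IsCopyBag b → EmptyBag D b
    notCopyBag⇒empty b notCopyBag v v∈b =
      notCopyBag (c , trans (sym (copy⊆copyBag c j))
                            (trans (cong (bag D) (combine-remQuot {3} n v)) v∈b))
      where
      c = proj₁ (remQuot {3} n v)
      j = proj₂ (remQuot {3} n v)

    surjective⇒threeNodes : Surjective-copyBag → k (tree D) ≡ 2
    surjective⇒threeNodes surj = suc-injective (≤-antisym
      (injective⇒≤ {f = section} section-injective) (injective⇒≤ {f = copyBag} copyBag-injective))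
      where
      section : Node (tree D) → Fin 3
      section b = proj₁ (surj b)
      section-injective : Injective _≡_ _≡_ section
      section-injective {b} {b'} same =
        trans (sym (proj₂ (surj b))) (trans (cong copyBag same) (proj₂ (surj b')))

    separatedRoots⇒1≤adhNode : ∀ mid a b → ¬ a ≡ b →
      separatedByNode (tree D) mid (copyBag a) (copyBag b) ≡ true → 1 ≤ adhNode D mid
    separatedRoots⇒1≤adhNode mid a b a≢b separated =
      ≤-trans (≤-reflexive (sym (trans (mult-vertex a zero b zero) (mult-betweenRoots a b a≢b))))
        (mult≤countEdges G (λ u w → separatedByNode (tree D) mid (bag D u) (bag D w))
          (λ u w → separatedByNode-sym (tree D) mid (bag D u) (bag D w))
          (vertex a zero) (vertex b zero) separated)

    copyBag-separatesNoCopyBags : ∀ c a b → ¬ a ≡ b →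
      ¬ separatedByNode (tree D) (copyBag c) (copyBag a) (copyBag b) ≡ true
    copyBag-separatesNoCopyBags c a b a≢b separated = 1+n≰n (begin
      suc n                                         ≡⟨ +-comm 1 n ⟩
      n + 1                                         ≤⟨ +-mono-≤ copy≤bag adh≥1 ⟩
      bagSize D (copyBag c) + adhNode D (copyBag c) ≤⟨ bagSize+adhNode≤width D (copyBag c) ⟩
      width D                                       ≤⟨ width≤n ⟩
      n                                             ∎)
      where
      open ≤-Reasoning
      copy≤bag : n ≤ bagSize D (copyBag c)
      copy≤bag = copy⊆bag⇒n≤bagSize D c (copyBag c) (copy⊆copyBag c)
      adh≥1 : 1 ≤ adhNode D (copyBag c)
      adh≥1 = separatedRoots⇒1≤adhNode (copyBag c) a b a≢b separated

    surjective⇒noSeparatingNode : Surjective-copyBag →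
      ∀ mid x y → ¬ x ≡ y → ¬ separatedByNode (tree D) mid x y ≡ true
    surjective⇒noSeparatingNode surj mid x y with surj mid | surj x | surj y
    ... | c , refl | a , refl | b , refl =
      λ x≢y → copyBag-separatesNoCopyBags c a b (λ a≡b → x≢y (cong copyBag a≡b))

    copyBag-not-surjective : ¬ Surjective-copyBag
    copyBag-not-surjective surj
      with mid , x , y , x≢y , separated ← threeNodeTree-middle (tree D) (surjective⇒threeNodes surj)
      = surjective⇒noSeparatingNode surj mid x y x≢y separated

    emptyBag-exists : ∃ λ b → EmptyBag D b
    emptyBag-exists =
      let b , notCopyBag =
            ¬∀⟶∃¬ _ IsCopyBag (λ b → any? (λ c → copyBag c ≟ᶠ b)) copyBag-not-surjective
      in  b , notCopyBag⇒empty b notCopyBag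

  withinCopyArcs : ℕ
  withinCopyArcs = sumFin² {n} {n} (λ j j' → if j == j' then 0 else l)

  betweenRootArcs : sumFin² {n} {n} (λ j j' →
    if (toℕ j ≡ᵇ 0) ∧ (toℕ j' ≡ᵇ 0) then 1 else 0) ≡ 1
  betweenRootArcs = cong₂ _+_ (cong suc (sumFin-zero m)) (sumFin²-zero m n)

  copyPairArcs : Fin 3 → Fin 3 → ℕ
  copyPairArcs c c' = if c == c' then withinCopyArcs else 1

  sumFin²-multPair : ∀ c c' →
    sumFin² {n} {n} (λ j j' → multPair l (c , j) (c' , j')) ≡ copyPairArcs c c'
  sumFin²-multPair c c' =
    trans (sumFin²-if {n} {n} (c == c')
            (λ j j' → if j == j' then 0 else l)
            (λ j j' → if (toℕ j ≡ᵇ 0) ∧ (toℕ j' ≡ᵇ 0) then 1 else 0))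
          (cong (if c == c' then withinCopyArcs else_) betweenRootArcs)

  countArcs-byCopy : (P : Fin (3 * n) → Fin (3 * n) → Bool) (Q : Fin 3 → Fin 3 → Bool) →
    (∀ c j c' j' → P (vertex c j) (vertex c' j') ≡ Q c c') →
    countArcs G P ≡ sumFin² (λ c c' → if Q c c' then copyPairArcs c c' else 0)
  countArcs-byCopy P Q P≡Q = begin
    countArcs G P
      ≡⟨ sumFin-combine 3 n (λ u → sumFin (arcs u)) ⟩
    sumFin² (λ c j → sumFin (arcs (vertex c j)))
      ≡⟨ sumFin-cong {3} (λ c → sumFin-cong {n} (λ j → sumFin-combine 3 n (arcs (vertex c j)))) ⟩
    sumFin² (λ c j → sumFin² (λ c' j' → arcs (vertex c j) (vertex c' j')))
      ≡⟨ sumFin-cong {3} (λ c → sumFin-comm (λ j c' →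
           sumFin (λ j' → arcs (vertex c j) (vertex c' j')))) ⟩
    sumFin² (λ c c' → sumFin² (λ j j' → arcs (vertex c j) (vertex c' j')))
      ≡⟨ sumFin-cong {3} (λ c → sumFin-cong {3} (λ c' →
           sumFin-cong {n} (λ j → sumFin-cong {n} (λ j' →
           cong₂ (λ β a → if β then a else 0) (P≡Q c j c' j') (mult-vertex c j c' j'))))) ⟩
    sumFin² (λ c c' →
      sumFin² {n} {n} (λ j j' → if Q c c' then multPair l (c , j) (c' , j') else 0))
      ≡⟨ sumFin-cong {3} (λ c → sumFin-cong {3} (λ c' → arcsBetween c c')) ⟩
    sumFin² (λ c c' → if Q c c' then copyPairArcs c c' else 0) ∎
    where
    open ≡-Reasoning
    arcs : Fin (3 * n) → Fin (3 * n) → ℕ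
    arcs u w = if P u w then mult G u w else 0
    arcsBetween : ∀ c c' →
      sumFin² {n} {n} (λ j j' → if Q c c' then multPair l (c , j) (c' , j') else 0)
      ≡ (if Q c c' then copyPairArcs c c' else 0)
    arcsBetween c c' =
      trans (sumFin²-if {n} {n} (Q c c') (λ j j' → multPair l (c , j) (c' , j')) (λ _ _ → 0))
            (cong₂ (if Q c c' then_else_) (sumFin²-multPair c c') (sumFin²-zero n n))

  star : RootedTree
  star = record { k = 3 ; parent = λ _ → zero ; parent-lt = λ _ → z≤n }

  D★ : TreeCutDecomposition G
  D★ = record { tree = star ; bag = λ v → suc (proj₁ (remQuot {3} n v)) }

  bag★-vertex : ∀ c j → bag D★ (vertex c j) ≡ suc c
  bag★-vertex c j = cong (λ p → suc (proj₁ p)) (remQuot-combine {3} {n} c j)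

  countEdges★-byLeaves : (R : Node star → Node star → Bool) → (∀ x y → R x y ≡ R y x) →
    let P = λ u w → R (bag D★ u) (bag D★ w) in
    countEdges G P + countEdges G P
      ≡ sumFin² (λ c c' → if R (suc c) (suc c') then copyPairArcs c c' else 0)
  countEdges★-byLeaves R R-sym =
    trans (countEdges-double G (λ u w → R (bag D★ u) (bag D★ w))
                                (λ u w → R-sym (bag D★ u) (bag D★ w)))
          (countArcs-byCopy (λ u w → R (bag D★ u) (bag D★ w)) (λ c c' → R (suc c) (suc c'))
            (λ c j c' j' → cong₂ R (bag★-vertex c j) (bag★-vertex c' j')))

  adhLink★ : ∀ i → adhLink D★ i ≡ 2
  adhLink★ i = +-self-injective
    (trans (countEdges★-byLeaves (crossesLink star i) (crossesLink-sym star i)) (arcs i))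
    where
    arcs : ∀ i →
      sumFin² (λ c c' → if crossesLink star i (suc c) (suc c') then copyPairArcs c c' else 0)
        ≡ 2 + 2
    arcs zero             = refl
    arcs (suc zero)       = refl
    arcs (suc (suc zero)) = refl

  adhNode★-centre : adhNode D★ zero ≡ 3
  adhNode★-centre =
    +-self-injective
      (countEdges★-byLeaves (separatedByNode star zero) (separatedByNode-sym star zero))

  adhNode★-leaf : ∀ c → adhNode D★ (suc c) ≡ 0
  adhNode★-leaf c = countEdges-false G _ (λ u w →
    trans (cong (not (bag D★ u == suc c) ∧_) (∧-zeroʳ (not (bag D★ w == suc c))))
          (∧-zeroʳ (not (bag D★ u == suc c))))

  bagSize★-leaf : ∀ c → bagSize D★ (suc c) ≡ n
  bagSize★-leaf c = begin
    bagSize D★ (suc c)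
      ≡⟨ bagSize-byCopy D★ (suc c) ⟩
    sumFin (copyInBag D★ (suc c))
      ≡⟨ sumFin-cong {3} (λ c' → sumFin-cong {n} (λ j →
           cong (λ x → if x == suc c then 1 else 0) (bag★-vertex c' j))) ⟩
    sumFin {3} (λ c' → sumFin {n} (λ _ → if suc c' == suc c then 1 else 0))
      ≡⟨ sumFin-cong {3} (λ c' → sumFin-if {n} (suc c' == suc c) (λ _ → 1) (λ _ → 0)) ⟩
    sumFin {3} (λ c' → if suc c' == suc c then sumFin {n} (λ _ → 1) else sumFin {n} (λ _ → 0))
      ≡⟨ sumFin-cong {3} (λ c' →
           cong₂ (if suc c' == suc c then_else_) (sumFin-one n) (sumFin-zero n)) ⟩
    sumFin {3} (λ c' → if suc c' == suc c then n else 0)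
      ≡⟨ oneLeaf c ⟩
    n ∎
    where
    open ≡-Reasoning
    oneLeaf : ∀ c → sumFin {3} (λ c' → if suc c' == suc c then n else 0) ≡ n
    oneLeaf zero             = +-identityʳ n
    oneLeaf (suc zero)       = +-identityʳ n
    oneLeaf (suc (suc zero)) = +-identityʳ n

  width★≤n : 3 ≤ n → width D★ ≤ n
  width★≤n 3≤n = ⊔-lub (maxFin-lub (adhLink D★) link≤n) (maxFin-lub _ node≤n)
    where
    link≤n : ∀ i → adhLink D★ i ≤ n
    link≤n i = ≤-trans (≤-reflexive (adhLink★ i)) (≤-trans (n≤1+n 2) 3≤n)
    node≤n : ∀ b → bagSize D★ b + adhNode D★ b ≤ n
    node≤n zero    = subst (_≤ n) (sym (cong₂ _+_ (sumFin-zero (3 * n)) adhNode★-centre)) 3≤n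
    node≤n (suc c) =
      ≤-reflexive (trans (cong₂ _+_ (bagSize★-leaf c) (adhNode★-leaf c)) (+-identityʳ n))

mainTheorem5 : ∀ (n l : ℕ) → 3 ≤ n → n < l →
    ScwEquals (K3∘Knl n l) n
    × (∀ (D : TreeCutDecomposition (K3∘Knl n l)) → width D ≡ n →
    ∃ λ b → EmptyBag D b)
mainTheorem5 zero    l ()  n<l
mainTheorem5 (suc m) l 3≤n n<l =
  ( (D★ , ≤-antisym (width★≤n 3≤n) (scw-lowerBound n<l D★))
  , scw-lowerBound n<l )
  , λ D width≡n → NarrowDecomposition.emptyBag-exists n<l D (≤-reflexive width≡n)
  where open K3∘Knl-Properties m l
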